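{- (i) If $n=pq$ where $p<q$ are primes and $n\mid \sigma_3(n)$, then $n=6$. (ii) If $n=2^\alpha p$ where $\alpha\geq 1$ is an integer, $p$ is an odd prime, and $n\mid\sigma_3(n)$, then $n$ is an even perfect number. (iii) Conversely, $6\mid\sigma_3(6)$, and every even perfect number $n$ other than $28$ satisfies $n\mid\sigma_3(n)$.
   Context: $\sigma_3(n)=\sum_{d\mid n} d^3$ is the sum of cubes of the positive divisors of $n$. A perfect number is a positive integer $n$ equal to the sum of its positive divisors less than $n$. -}

module Defs where

open import Data.Nat using (ℕ; suc; _∸_; _^_; _≤_)
open import Data.Nat.Divisibility using (_∣_; _∣?_)
open import Data.List using (List; filter; upTo; map)
open import Data.Nat.ListAction using (sum)
open import Data.Product using (_×_)
open import Relation.Binary.PropositionalEquality using (_≡_)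

divisors : ℕ → List ℕ
divisors n = filter (_∣? n) (map suc (upTo n))

σ₃ : ℕ → ℕ
σ₃ n = sum (map (λ d → d ^ 3) (divisors n))

properDivisors : ℕ → List ℕ
properDivisors n = filter (_∣? n) (map suc (upTo (n ∸ 1)))

Perfect : ℕ → Set
Perfect n = (1 ≤ n) × (sum (properDivisors n) ≡ n)

{-# OPTIONS --safe #-}

-- σ₃ is multiplicative: for p prime with p ∤ b, σ₃ (p ^ k * b) = (1 + p³ + ⋯ + p³ᵏ) σ₃ b,
-- and 1 + a³ = (1 + a) Φ₆ a with Φ₆ a = a² − a + 1.
-- (i) For n = p q one gets q ∣ (1 + p) Φ₆ p and p ∣ (1 + q) Φ₆ q. If q ∣ p + 1 then (p, q) = (2, 3);
-- if p ∣ q + 1 a size comparison gives the same; and b ∣ Φ₆ a, a ∣ Φ₆ b with a ≤ b forces a = 1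
-- by Vieta-style descent (Φ₆ a = m b with m < a yields a ∣ Φ₆ m).
-- (ii) For n = 2^α p, the odd factor σ₃ (2^α) forces 2^α ∣ p + 1 and p ∣ σ₃ (2^α). Since
-- 7 σ₃ (2^α) = M Φ₃ (M + 1) with M = 2^(α+1) − 1 and Φ₃ y = y² + y + 1, either p ∣ M, and then p = M
-- by size, or p ∣ Φ₃ (2 x) with x = 2^α and p + 1 = c x, which reduces to j c x = 4 x + j + c + 2;
-- of its finitely many solutions only p = M survives. So n = 2^α M with M prime is perfect.
-- (iv) By Euler an even perfect number is 2^k M with M = 2^(k+1) − 1 prime. Then 2^k ∣ M + 1 ∣ 1 + M³,
-- and M ∣ σ₃ (2^k) because M ∣ 7 σ₃ (2^k) and M ≠ 7 (which would give n = 28).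
module Submission where

open import Defs
open import Data.Nat using (ℕ; zero; suc; _+_; _*_; _^_; _∸_; _≤_; _<_; _≥_; _>_; _≤?_; z≤n; s≤s;
  NonZero; ≢-nonZero; ≢-nonZero⁻¹; >-nonZero; z<s; n>1⇒nonTrivial; nonTrivial⇒n>1; >-nonZero⁻¹)
open import Data.Nat.Properties
open import Data.Nat.Induction using (<-wellFounded)
open import Induction.WellFounded using (Acc; acc)
open import Data.Nat.Divisibility
open import Data.Nat.Divisibility.Core using (hasNonTrivialDivisor)
open import Data.Nat.Coprimality using (Coprime; coprime-divisor)
import Data.Nat.Coprimality as Coprime
open import Data.Nat.Primality using (Prime; prime⇒irreducible; prime⇒nonZero; ¬prime[1]; prime[2]; prime?; euclidsLemma)
open import Data.Nat.ListAction using (sum)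
open import Data.Nat.ListAction.Properties using (sum-++; sum-↭)
open import Data.List using (List; []; _∷_; _++_; [_]; map; filter; upTo)
open import Data.List.Properties using (map-++; map-∘; map-id; filter-++; filter-accept; upTo-∷ʳ)
open import Data.List.Membership.Propositional using (_∈_)
open import Data.List.Relation.Unary.Any using (here; there)
import Data.List.Relation.Unary.All as All
import Data.List.Relation.Unary.AllPairs as AllPairs
open import Data.List.Membership.Propositional.Properties
  using (∈-filter⁺; ∈-filter⁻; ∈-map⁺; ∈-map⁻; ∈-upTo⁺; ∈-++⁺ˡ; ∈-++⁺ʳ; ∈-++⁻)
open import Data.List.Membership.Propositional.Properties.WithK using (unique∧set⇒bag)
open import Data.Product.Properties using (≡-dec)
open import Data.List.Membership.DecPropositional _≟_ using (_∈?_)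
open import Data.List.Membership.DecPropositional (≡-dec _≟_ _≟_) using () renaming (_∈?_ to _∈ᵖ?_)
open import Data.List.Relation.Binary.Subset.Propositional using (_⊆_)
open import Data.List.Relation.Binary.BagAndSetEquality using (∼bag⇒↭)
open import Data.List.Relation.Binary.Permutation.Propositional using (_↭_)
import Data.List.Relation.Binary.Permutation.Propositional.Properties as ↭
open import Data.List.Relation.Unary.Unique.Propositional using (Unique)
import Data.List.Relation.Unary.Unique.Propositional.Properties as Unique
open import Data.Nat.Tactic.RingSolver using (solve-∀; solve)
open import Algebra.Properties.CommutativeSemiring.Exp +-*-commutativeSemiring using (^-distrib-*)
open import Data.Product using (∃; _×_; _,_; proj₁; proj₂)
open import Data.Sum using (_⊎_; inj₁; inj₂; [_,_]′)
open import Function using (id; _∘_; _⇔_; mk⇔)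
open import Relation.Binary.PropositionalEquality hiding ([_])
open import Relation.Nullary using (¬_; yes; no; ¬?; contradiction)
open import Relation.Nullary.Decidable using (_→-dec_; from-yes; from-no)

sum-map-↭ : ∀ (f : ℕ → ℕ) {xs ys} → xs ↭ ys → sum (map f xs) ≡ sum (map f ys)
sum-map-↭ f xs↭ys = sum-↭ (↭.map⁺ f xs↭ys)

sum-map-++ : ∀ (f : ℕ → ℕ) xs ys → sum (map f (xs ++ ys)) ≡ sum (map f xs) + sum (map f ys)
sum-map-++ f xs ys = trans (cong sum (map-++ f xs ys)) (sum-++ (map f xs) (map f ys))

sum-map-*ˡ : ∀ (f g : ℕ → ℕ) c → (∀ x → g x ≡ c * f x) → ∀ xs → sum (map g xs) ≡ c * sum (map f xs)
sum-map-*ˡ f g c g≡c*f []       = sym (*-zeroʳ c)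
sum-map-*ˡ f g c g≡c*f (x ∷ xs) = begin
  g x + sum (map g xs)            ≡⟨ cong₂ _+_ (g≡c*f x) (sum-map-*ˡ f g c g≡c*f xs) ⟩
  c * f x + c * sum (map f xs)    ≡⟨ *-distribˡ-+ c (f x) _ ⟨
  c * (f x + sum (map f xs))      ∎
  where open ≡-Reasoning

unique-⇔⇒↭ : ∀ {xs ys : List ℕ} → Unique xs → Unique ys → (∀ {x} → x ∈ xs ⇔ x ∈ ys) → xs ↭ ys
unique-⇔⇒↭ xs! ys! xs⇔ys = ∼bag⇒↭ (unique∧set⇒bag xs! ys! xs⇔ys)

sum-map-mono-⊆ : ∀ (f : ℕ → ℕ) {xs ys} → Unique xs → Unique ys → xs ⊆ ys →
                 sum (map f xs) ≤ sum (map f ys)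
sum-map-mono-⊆ f {xs} {ys} xs! ys! xs⊆ys = begin
  sum (map f xs)                      ≤⟨ m≤m+n _ _ ⟩
  sum (map f xs) + sum (map f rest)   ≡⟨ sum-map-++ f xs rest ⟨
  sum (map f (xs ++ rest))            ≡⟨ sum-map-↭ f ys↭xs++rest ⟨
  sum (map f ys)                      ∎
  where
  open ≤-Reasoning
  ∉xs? = λ y → ¬? (y ∈? xs)
  rest = filter ∉xs? ys
  to : ∀ {y} → y ∈ ys → y ∈ xs ++ rest
  to {y} y∈ys with y ∈? xs
  ... | yes y∈xs = ∈-++⁺ˡ y∈xs
  ... | no  y∉xs = ∈-++⁺ʳ xs (∈-filter⁺ ∉xs? y∈ys y∉xs)
  from : ∀ {y} → y ∈ xs ++ rest → y ∈ ys
  from y∈ with ∈-++⁻ xs y∈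
  ... | inj₁ y∈xs   = xs⊆ys y∈xs
  ... | inj₂ y∈rest = proj₁ (∈-filter⁻ ∉xs? {xs = ys} y∈rest)
  ys↭xs++rest : ys ↭ xs ++ rest
  ys↭xs++rest = unique-⇔⇒↭ ys!
    (Unique.++⁺ xs! (Unique.filter⁺ ∉xs? ys!) (λ (y∈xs , y∈rest) → proj₂ (∈-filter⁻ ∉xs? {xs = ys} y∈rest) y∈xs))
    (mk⇔ to from)

divisors-unique : ∀ n → Unique (divisors n)
divisors-unique n = Unique.filter⁺ (_∣? n) (Unique.map⁺ suc-injective (Unique.upTo⁺ n))

∈-divisors⁻ : ∀ {d n} → d ∈ divisors n → d ∣ n
∈-divisors⁻ {n = n} d∈ = proj₂ (∈-filter⁻ (_∣? n) {xs = map suc (upTo n)} d∈)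

∈-divisors⁺ : ∀ {d n} .{{_ : NonZero n}} → d ∣ n → d ∈ divisors n
∈-divisors⁺ {zero}  {n} 0∣n = contradiction (0∣⇒≡0 0∣n) (≢-nonZero⁻¹ n)
∈-divisors⁺ {suc d} {n} d∣n = ∈-filter⁺ (_∣? n) (∈-map⁺ suc (∈-upTo⁺ (∣⇒≤ d∣n))) d∣n

σ[_] : (ℕ → ℕ) → ℕ → ℕ
σ[ f ] n = sum (map f (divisors n))

σ₁ : ℕ → ℕ
σ₁ = σ[ id ]

divisors-suc : ∀ m → divisors (suc m) ≡ properDivisors (suc m) ++ [ suc m ]
divisors-suc m = begin
  filter (_∣? suc m) (map suc (upTo (suc m)))                   ≡⟨ cong (filter (_∣? suc m) ∘ map suc) (upTo-∷ʳ m) ⟨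
  filter (_∣? suc m) (map suc (upTo m ++ [ m ]))                ≡⟨ cong (filter (_∣? suc m)) (map-++ suc (upTo m) [ m ]) ⟩
  filter (_∣? suc m) (map suc (upTo m) ++ [ suc m ])            ≡⟨ filter-++ (_∣? suc m) (map suc (upTo m)) [ suc m ] ⟩
  properDivisors (suc m) ++ filter (_∣? suc m) [ suc m ]        ≡⟨ cong (properDivisors (suc m) ++_) (filter-accept (_∣? suc m) ∣-refl) ⟩
  properDivisors (suc m) ++ [ suc m ]                           ∎
  where open ≡-Reasoning

σ₁-suc : ∀ m → σ₁ (suc m) ≡ sum (properDivisors (suc m)) + suc m
σ₁-suc m = begin
  σ₁ (suc m)                                            ≡⟨ cong (sum ∘ map id) (divisors-suc m) ⟩
  sum (map id (properDivisors (suc m) ++ [ suc m ]))    ≡⟨ sum-map-++ id (properDivisors (suc m)) [ suc m ] ⟩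
  sum (map id (properDivisors (suc m))) + (suc m + 0)   ≡⟨ cong₂ _+_ (cong sum (map-id (properDivisors (suc m)))) (+-identityʳ (suc m)) ⟩
  sum (properDivisors (suc m)) + suc m                  ∎
  where open ≡-Reasoning

perfect⁺ : ∀ {n} .{{_ : NonZero n}} → σ₁ n ≡ n + n → Perfect n
perfect⁺ {suc m} σ₁≡2n = s≤s z≤n , +-cancelʳ-≡ (suc m) _ _ (trans (sym (σ₁-suc m)) σ₁≡2n)

perfect⁻ : ∀ {n} → Perfect n → σ₁ n ≡ n + n
perfect⁻ {suc m} (_ , s≡n) = trans (σ₁-suc m) (cong (_+ suc m) s≡n)

prime∤1 : ∀ {p} → Prime p → ¬ p ∣ 1
prime∤1 p-prime p∣1 = ¬prime[1] (subst Prime (∣1⇒≡1 p∣1) p-prime)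

prime∤⇒coprime : ∀ {p m} → Prime p → ¬ p ∣ m → Coprime p m
prime∤⇒coprime p-prime p∤m (d∣p , d∣m) with prime⇒irreducible p-prime d∣p
... | inj₁ d≡1 = d≡1
... | inj₂ refl = contradiction d∣m p∤m

prime∤⇒coprime-^ : ∀ {p m} k → Prime p → ¬ p ∣ m → Coprime (p ^ k) m
prime∤⇒coprime-^ zero    _       _   (d∣1 , _) = ∣1⇒≡1 d∣1
prime∤⇒coprime-^ (suc k) p-prime p∤m {d} (d∣p^[1+k] , d∣m) =
  prime∤⇒coprime-^ k p-prime p∤m (coprime-divisor d⊥p d∣p^[1+k] , d∣m)
  where
  d⊥p : Coprime d _
  d⊥p = Coprime.sym (prime∤⇒coprime p-prime (λ p∣d → p∤m (∣-trans p∣d d∣m)))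

geometricSum : ℕ → ℕ → ℕ
geometricSum r zero    = 1
geometricSum r (suc k) = 1 + r * geometricSum r k

module _ {p b : ℕ} (p-prime : Prime p) (p∤b : ¬ p ∣ b) where

  private instance
    p≢0 : NonZero p
    p≢0 = prime⇒nonZero p-prime
    b≢0 : NonZero b
    b≢0 = ≢-nonZero λ { refl → p∤b (p ∣0) }

  divisors-prime^suc-↭ : ∀ k → divisors (p ^ suc k * b) ↭ divisors b ++ map (p *_) (divisors (p ^ k * b))
  divisors-prime^suc-↭ k = unique-⇔⇒↭ (divisors-unique (p ^ suc k * b))
    (Unique.++⁺ (divisors-unique b) (Unique.map⁺ (*-cancelˡ-≡ _ _ p) (divisors-unique (p ^ k * b))) disjoint)
    (mk⇔ to from)
    where
    instance
      p^k*b≢0 : NonZero (p ^ k * b)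
      p^k*b≢0 = m*n≢0 (p ^ k) b {{m^n≢0 p k}}
      p^[1+k]*b≢0 : NonZero (p ^ suc k * b)
      p^[1+k]*b≢0 = m*n≢0 (p ^ suc k) b {{m^n≢0 p (suc k)}}
    p^[1+k]*b≡p*[p^k*b] : p ^ suc k * b ≡ p * (p ^ k * b)
    p^[1+k]*b≡p*[p^k*b] = *-assoc p (p ^ k) b
    to : ∀ {d} → d ∈ divisors (p ^ suc k * b) → d ∈ divisors b ++ map (p *_) (divisors (p ^ k * b))
    to {d} d∈ with p ∣? d
    ... | no p∤d = ∈-++⁺ˡ (∈-divisors⁺ (coprime-divisor d⊥p^[1+k] (∈-divisors⁻ d∈)))
      where d⊥p^[1+k] = Coprime.sym (prime∤⇒coprime-^ (suc k) p-prime p∤d)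
    ... | yes (divides e refl) = ∈-++⁺ʳ (divisors b) (subst (_∈ map (p *_) (divisors (p ^ k * b))) (*-comm p e) (∈-map⁺ (p *_) e∈))
      where
      e∈ : e ∈ divisors (p ^ k * b)
      e∈ = ∈-divisors⁺ (*-cancelˡ-∣ p (subst₂ _∣_ (*-comm e p) p^[1+k]*b≡p*[p^k*b] (∈-divisors⁻ d∈)))
    from : ∀ {d} → d ∈ divisors b ++ map (p *_) (divisors (p ^ k * b)) → d ∈ divisors (p ^ suc k * b)
    from {d} d∈ with ∈-++⁻ (divisors b) d∈
    ... | inj₁ d∈b = ∈-divisors⁺ (∣n⇒∣m*n (p ^ suc k) (∈-divisors⁻ d∈b))
    ... | inj₂ d∈p* with ∈-map⁻ (p *_) d∈p*
    ...   | e , e∈ , refl = ∈-divisors⁺ (subst (p * e ∣_) (sym p^[1+k]*b≡p*[p^k*b]) (*-monoʳ-∣ p (∈-divisors⁻ e∈)))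
    disjoint : ∀ {d} → ¬ (d ∈ divisors b × d ∈ map (p *_) (divisors (p ^ k * b)))
    disjoint (d∈b , d∈p*) with ∈-map⁻ (p *_) d∈p*
    ... | e , _ , refl = p∤b (∣-trans (m∣m*n e) (∈-divisors⁻ d∈b))

  σ-prime^k* : ∀ f → (∀ y → f (p * y) ≡ f p * f y) → ∀ k →
               σ[ f ] (p ^ k * b) ≡ geometricSum (f p) k * σ[ f ] b
  σ-prime^k* f f-mult zero    = trans (cong σ[ f ] (*-identityˡ b)) (sym (*-identityˡ _))
  σ-prime^k* f f-mult (suc k) = begin
    σ[ f ] (p ^ suc k * b)                                 ≡⟨ sum-map-↭ f (divisors-prime^suc-↭ k) ⟩
    sum (map f (divisors b ++ map (p *_) (divisors N)))    ≡⟨ sum-map-++ f (divisors b) _ ⟩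
    σ[ f ] b + sum (map f (map (p *_) (divisors N)))       ≡⟨ cong (λ ds → σ[ f ] b + sum ds) (map-∘ (divisors N)) ⟨
    σ[ f ] b + sum (map (f ∘ (p *_)) (divisors N))         ≡⟨ cong (σ[ f ] b +_) (sum-map-*ˡ f (f ∘ (p *_)) (f p) f-mult (divisors N)) ⟩
    σ[ f ] b + f p * σ[ f ] N                              ≡⟨ cong (λ s → σ[ f ] b + f p * s) (σ-prime^k* f f-mult k) ⟩
    σ[ f ] b + f p * (geometricSum (f p) k * σ[ f ] b)     ≡⟨ cong₂ _+_ (*-identityˡ (σ[ f ] b)) (*-assoc (f p) _ _) ⟨
    1 * σ[ f ] b + f p * geometricSum (f p) k * σ[ f ] b   ≡⟨ *-distribʳ-+ (σ[ f ] b) 1 (f p * geometricSum (f p) k) ⟨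
    geometricSum (f p) (suc k) * σ[ f ] b                  ∎
    where
    open ≡-Reasoning
    N = p ^ k * b

  σ-prime* : ∀ f → (∀ y → f (p * y) ≡ f p * f y) → σ[ f ] (p * b) ≡ (1 + f p) * σ[ f ] b
  σ-prime* f f-mult = begin
    σ[ f ] (p * b)                  ≡⟨ cong (λ q → σ[ f ] (q * b)) (*-identityʳ p) ⟨
    σ[ f ] (p ^ 1 * b)              ≡⟨ σ-prime^k* f f-mult 1 ⟩
    (1 + f p * 1) * σ[ f ] b        ≡⟨ cong (λ q → (1 + q) * σ[ f ] b) (*-identityʳ (f p)) ⟩
    (1 + f p) * σ[ f ] b            ∎
    where open ≡-Reasoning

σ-prime : ∀ f {p} → Prime p → (∀ y → f (p * y) ≡ f p * f y) → f 1 ≡ 1 → σ[ f ] p ≡ 1 + f p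
σ-prime f {p} p-prime f-mult f1≡1 = begin
  σ[ f ] p                    ≡⟨ cong σ[ f ] (*-identityʳ p) ⟨
  σ[ f ] (p * 1)              ≡⟨ σ-prime* p-prime (prime∤1 p-prime) f f-mult ⟩
  (1 + f p) * (f 1 + 0)       ≡⟨ cong (λ s → (1 + f p) * s) (trans (+-identityʳ (f 1)) f1≡1) ⟩
  (1 + f p) * 1               ≡⟨ *-identityʳ _ ⟩
  1 + f p                     ∎
  where open ≡-Reasoning

cube-* : ∀ m n → (m * n) ^ 3 ≡ m ^ 3 * n ^ 3
cube-* m n = ^-distrib-* m n 3

σ₃-prime^k* : ∀ {p b} → Prime p → ¬ p ∣ b → ∀ k → σ₃ (p ^ k * b) ≡ geometricSum (p ^ 3) k * σ₃ b
σ₃-prime^k* {p} p-prime p∤b = σ-prime^k* p-prime p∤b (_^ 3) (cube-* p)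

σ₃-prime* : ∀ {p b} → Prime p → ¬ p ∣ b → σ₃ (p * b) ≡ (1 + p ^ 3) * σ₃ b
σ₃-prime* {p} p-prime p∤b = σ-prime* p-prime p∤b (_^ 3) (cube-* p)

σ₃-prime : ∀ {p} → Prime p → σ₃ p ≡ 1 + p ^ 3
σ₃-prime {p} p-prime = σ-prime (_^ 3) p-prime (cube-* p) refl

σ₁-prime^k* : ∀ {p b} → Prime p → ¬ p ∣ b → ∀ k → σ₁ (p ^ k * b) ≡ geometricSum p k * σ₁ b
σ₁-prime^k* p-prime p∤b = σ-prime^k* p-prime p∤b id (λ _ → refl)

σ₁-prime : ∀ {p} → Prime p → σ₁ p ≡ 1 + p
σ₁-prime p-prime = σ-prime id p-prime (λ _ → refl) refl

2∤1 : ¬ 2 ∣ 1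
2∤1 2∣1 = contradiction (∣1⇒≡1 2∣1) λ ()

even∨odd : ∀ n → 2 ∣ n ⊎ 2 ∣ suc n
even∨odd zero    = inj₁ (2 ∣0)
even∨odd (suc n) with even∨odd n
... | inj₁ 2∣n   = inj₂ (∣m∣n⇒∣m+n (divides 1 refl) 2∣n)
... | inj₂ 2∣1+n = inj₁ 2∣1+n

2∣⇒2∤suc : ∀ {n} → 2 ∣ n → ¬ 2 ∣ suc n
2∣⇒2∤suc {n} 2∣n 2∣1+n = 2∤1 (∣m+n∣m⇒∣n (subst (2 ∣_) (+-comm 1 n) 2∣1+n) 2∣n)

geometricSum-odd : ∀ {r} → 2 ∣ r → ∀ k → ¬ 2 ∣ geometricSum r k
geometricSum-odd 2∣r zero    = 2∤1
geometricSum-odd 2∣r (suc k) = 2∣⇒2∤suc (∣m⇒∣m*n _ 2∣r)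

geometricSum≢0 : ∀ r k → NonZero (geometricSum r k)
geometricSum≢0 r zero    = _
geometricSum≢0 r (suc k) = _

geometricSum-closed : ∀ r k → suc (r * geometricSum (suc r) k) ≡ suc r ^ suc k
geometricSum-closed r zero    = trans (cong suc (*-identityʳ r)) (sym (*-identityʳ (suc r)))
geometricSum-closed r (suc k) = begin
  suc (r * (1 + suc r * G))    ≡⟨ expand r G ⟩
  suc r * suc (r * G)          ≡⟨ cong (suc r *_) (geometricSum-closed r k) ⟩
  suc r * suc r ^ suc k        ∎
  where
  open ≡-Reasoning
  G = geometricSum (suc r) k
  expand : ∀ r g → suc (r * (1 + suc r * g)) ≡ suc r * suc (r * g)
  expand = solve-∀

geometricSum-2 : ∀ k → suc (geometricSum 2 k) ≡ 2 ^ suc k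
geometricSum-2 k = trans (cong suc (sym (*-identityˡ _))) (geometricSum-closed 1 k)

Φ₃ : ℕ → ℕ
Φ₃ y = 1 + y + y * y

Φ₆ : ℕ → ℕ
Φ₆ a = 1 + a * (a ∸ 1)

geometricSum-8 : ∀ k → 7 * geometricSum 8 k ≡ geometricSum 2 k * Φ₃ (suc (geometricSum 2 k))
geometricSum-8 k = suc-injective (begin
  suc (7 * geometricSum 8 k)   ≡⟨ geometricSum-closed 7 k ⟩
  (2 ^ 3) ^ suc k              ≡⟨ ^-*-assoc 2 3 (suc k) ⟩
  2 ^ (3 * suc k)              ≡⟨ cong (2 ^_) (*-comm 3 (suc k)) ⟩
  2 ^ (suc k * 3)              ≡⟨ ^-*-assoc 2 (suc k) 3 ⟨
  (2 ^ suc k) ^ 3              ≡⟨ cong (_^ 3) (geometricSum-2 k) ⟨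
  suc M ^ 3                    ≡⟨ cube M ⟩
  suc (M * Φ₃ (suc M))         ∎)
  where
  open ≡-Reasoning
  M = geometricSum 2 k
  cube : ∀ m → suc m * (suc m * (suc m * 1)) ≡ suc (m * (1 + suc m + suc m * suc m))
  cube = solve-∀

1+a³≡[1+a]*Φ₆a : ∀ a → 1 + a ^ 3 ≡ (1 + a) * Φ₆ a
1+a³≡[1+a]*Φ₆a zero     = refl
1+a³≡[1+a]*Φ₆a (suc a₁) = factor a₁
  where
  factor : ∀ a₁ → 1 + suc a₁ * (suc a₁ * (suc a₁ * 1)) ≡ (1 + suc a₁) * (1 + suc a₁ * a₁)
  factor = solve-∀

Φ₆-odd : ∀ a → ¬ 2 ∣ Φ₆ a
Φ₆-odd a = 2∣⇒2∤suc (even a)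
  where
  even : ∀ a → 2 ∣ a * (a ∸ 1)
  even zero     = 2 ∣0
  even (suc a₁) with even∨odd a₁
  ... | inj₁ 2∣a₁   = ∣n⇒∣m*n (suc a₁) 2∣a₁
  ... | inj₂ 2∣1+a₁ = ∣m⇒∣m*n a₁ 2∣1+a₁

prime∤1+p³ : ∀ {p} → Prime p → ¬ p ∣ 1 + p ^ 3
prime∤1+p³ {p} p-prime p∣1+p³ =
  prime∤1 p-prime (∣m+n∣m⇒∣n (subst (p ∣_) (+-comm 1 (p ^ 3)) p∣1+p³) (m∣m*n (p ^ 2)))

consecutive-primes : ∀ {p} → Prime p → Prime (suc p) → p ≡ 2
consecutive-primes {p} p-prime 1+p-prime with even∨odd p
... | inj₁ 2∣p with prime⇒irreducible p-prime 2∣p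
...   | inj₁ ()
...   | inj₂ 2≡p = sym 2≡p
consecutive-primes {p} p-prime 1+p-prime | inj₂ 2∣1+p with prime⇒irreducible 1+p-prime 2∣1+p
...   | inj₁ ()
...   | inj₂ refl = contradiction p-prime ¬prime[1]

Φ₆-coprime : ∀ {d} n → d ∣ n * (n ∸ 1) → d ∣ Φ₆ n → d ≡ 1
Φ₆-coprime {d} n d∣n[n∸1] d∣Φ₆n =
  ∣1⇒≡1 (∣m+n∣m⇒∣n (subst (d ∣_) (+-comm 1 (n * (n ∸ 1))) d∣Φ₆n) d∣n[n∸1])

Φ₆-quotient-< : ∀ {a b m} .{{_ : NonZero a}} → a < b → Φ₆ a ≡ m * b → m < a
Φ₆-quotient-< {a@(suc a₁)} {b} {m} a<b Φ₆a≡m*b = *-cancelʳ-< b m a (begin-strict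
  m * b          ≡⟨ Φ₆a≡m*b ⟨
  1 + a * a₁     ≤⟨ +-monoˡ-≤ (a * a₁) (s≤s (z≤n {a₁})) ⟩
  a + a * a₁     ≡⟨ *-suc a a₁ ⟨
  a * a          <⟨ *-monoʳ-< a a<b ⟩
  a * b          ∎)
  where open ≤-Reasoning

Φ₆-descent-identity : ∀ A m₁ b₁ → 1 + A ≡ suc m₁ * suc b₁ →
                      suc m₁ * suc m₁ * Φ₆ (suc b₁) ≡ A * (1 + suc m₁ * b₁) + Φ₆ (suc m₁)
Φ₆-descent-identity A m₁ b₁ e = begin
  suc m₁ * suc m₁ * (1 + suc b₁ * b₁)                       ≡⟨ solve (m₁ ∷ b₁ ∷ []) ⟩
  suc m₁ * m₁ + suc m₁ + suc m₁ * suc b₁ * (suc m₁ * b₁)    ≡⟨ cong (λ y → suc m₁ * m₁ + suc m₁ + y * (suc m₁ * b₁)) e ⟨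
  suc m₁ * m₁ + suc m₁ + (1 + A) * (suc m₁ * b₁)            ≡⟨ solve (m₁ ∷ b₁ ∷ A ∷ []) ⟩
  suc m₁ * m₁ + suc m₁ * suc b₁ + A * (suc m₁ * b₁)         ≡⟨ cong (λ y → suc m₁ * m₁ + y + A * (suc m₁ * b₁)) e ⟨
  suc m₁ * m₁ + (1 + A) + A * (suc m₁ * b₁)                 ≡⟨ solve (m₁ ∷ b₁ ∷ A ∷ []) ⟩
  A * (1 + suc m₁ * b₁) + (1 + suc m₁ * m₁)                 ∎
  where open ≡-Reasoning

Φ₆-descent-step : ∀ a {b m} → Φ₆ a ≡ m * b → a ∣ Φ₆ b → a ∣ Φ₆ m
Φ₆-descent-step a {zero}   {m}      Φ₆a≡m*b _ = contradiction (trans Φ₆a≡m*b (*-zeroʳ m)) λ ()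
Φ₆-descent-step a {suc b₁} {zero}   ()      _
Φ₆-descent-step a {suc b₁} {suc m₁} Φ₆a≡m*b a∣Φ₆b = ∣m+n∣m⇒∣n
  (subst (a ∣_) (Φ₆-descent-identity (a * (a ∸ 1)) m₁ b₁ Φ₆a≡m*b) (∣n⇒∣m*n (suc m₁ * suc m₁) a∣Φ₆b))
  (∣m⇒∣m*n _ (m∣m*n (a ∸ 1)))

Φ₆-descent : ∀ {a b} .{{_ : NonZero a}} → a ≤ b → b ∣ Φ₆ a → a ∣ Φ₆ b → a ≡ 1
Φ₆-descent {a} = go (<-wellFounded a)
  where
  go : ∀ {a b} → Acc _<_ a → .{{_ : NonZero a}} → a ≤ b → b ∣ Φ₆ a → a ∣ Φ₆ b → a ≡ 1
  go {a} {b} (acc rec) a≤b b∣Φ₆a a∣Φ₆b with m≤n⇒m<n∨m≡n a≤b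
  ... | inj₂ refl = Φ₆-coprime a (m∣m*n (a ∸ 1)) a∣Φ₆b
  ... | inj₁ a<b with b∣Φ₆a
  ...   | divides m Φ₆a≡m*b = Φ₆-coprime (Φ₆ a) (∣n⇒∣m*n (Φ₆ a) (m∣m*n (a ∸ 1))) (subst (λ c → a ∣ Φ₆ c) b≡Φ₆a a∣Φ₆b)
    where
    m<a : m < a
    m<a = Φ₆-quotient-< a<b Φ₆a≡m*b
    m≢0 : NonZero m
    m≢0 = ≢-nonZero λ { refl → contradiction Φ₆a≡m*b λ () }
    m≡1 : m ≡ 1
    m≡1 = go (rec m<a) {{m≢0}} (<⇒≤ m<a) (Φ₆-descent-step a {b} {m} Φ₆a≡m*b a∣Φ₆b)
             (divides b (trans Φ₆a≡m*b (*-comm m b)))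
    b≡Φ₆a : b ≡ Φ₆ a
    b≡Φ₆a = sym (trans Φ₆a≡m*b (trans (cong (_* b) m≡1) (*-identityˡ b)))

Φ₆-∣-suc : ∀ {p q} → p < q → p ∣ suc q → q ∣ Φ₆ p → p ≡ 2 × q ≡ 3
Φ₆-∣-suc {zero}         _   0∣1+q _ = contradiction (0∣⇒≡0 0∣1+q) λ ()
Φ₆-∣-suc {p@(suc a₁)} {q} p<q p∣1+q (divides m Φ₆p≡m*q) = conclude a₁≡1 Φ₆p≡a₁*q
  where
  p∣1+m : p ∣ 1 + m
  p∣1+m = ∣m+n∣m⇒∣n (subst (p ∣_) m*[1+q]≡p*a₁+1+m (∣n⇒∣m*n m p∣1+q)) (m∣m*n a₁)
    where
    m*[1+q]≡p*a₁+1+m : m * suc q ≡ p * a₁ + (1 + m)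
    m*[1+q]≡p*a₁+1+m = begin
      m * suc q            ≡⟨ *-suc m q ⟩
      m + m * q            ≡⟨ cong (m +_) Φ₆p≡m*q ⟨
      m + (1 + p * a₁)     ≡⟨ +-suc m (p * a₁) ⟩
      1 + m + p * a₁       ≡⟨ +-comm (1 + m) (p * a₁) ⟩
      p * a₁ + (1 + m)     ∎
      where open ≡-Reasoning
  Φ₆p≡a₁*q : Φ₆ p ≡ a₁ * q
  Φ₆p≡a₁*q = trans Φ₆p≡m*q (cong (_* q) (suc-injective (≤-antisym (Φ₆-quotient-< p<q Φ₆p≡m*q) (∣⇒≤ p∣1+m))))
  a₁≡1 : a₁ ≡ 1
  a₁≡1 = Φ₆-coprime p (n∣m*n p) (divides q (trans Φ₆p≡a₁*q (*-comm a₁ q)))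
  conclude : ∀ {a₁} → a₁ ≡ 1 → Φ₆ (suc a₁) ≡ a₁ * q → suc a₁ ≡ 2 × q ≡ 3
  conclude refl 3≡q+0 = refl , sym (trans 3≡q+0 (+-identityʳ q))

semiprime∣σ₃⇒≡6 : (n p q : ℕ) → Prime p → Prime q → p < q → n ≡ p * q → n ∣ σ₃ n → n ≡ 6
semiprime∣σ₃⇒≡6 _ p q p-prime q-prime p<q refl pq∣σ₃ =
  [ q∣1+p⇒pq≡6 , q∣Φ₆p⇒pq≡6 ]′ (euclidsLemma (suc p) (Φ₆ p) q-prime q∣[1+p]Φ₆p)
  where
  p∤q : ¬ p ∣ q
  p∤q p∣q with prime⇒irreducible q-prime p∣q
  ... | inj₁ refl = ¬prime[1] p-prime
  ... | inj₂ refl = <-irrefl refl p<q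
  pq∣[1+p³][1+q³] : p * q ∣ (1 + p ^ 3) * (1 + q ^ 3)
  pq∣[1+p³][1+q³] = subst (p * q ∣_)
    (trans (σ₃-prime* p-prime p∤q) (cong ((1 + p ^ 3) *_) (σ₃-prime q-prime))) pq∣σ₃
  q∣[1+p]Φ₆p : q ∣ suc p * Φ₆ p
  q∣[1+p]Φ₆p = subst (q ∣_) (1+a³≡[1+a]*Φ₆a p)
    (coprime-divisor (prime∤⇒coprime q-prime (prime∤1+p³ q-prime))
      (subst (q ∣_) (*-comm (1 + p ^ 3) _) (∣-trans (n∣m*n p) pq∣[1+p³][1+q³])))
  p∣[1+q]Φ₆q : p ∣ suc q * Φ₆ q
  p∣[1+q]Φ₆q = subst (p ∣_) (1+a³≡[1+a]*Φ₆a q)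
    (coprime-divisor (prime∤⇒coprime p-prime (prime∤1+p³ p-prime))
      (∣-trans (m∣m*n q) pq∣[1+p³][1+q³]))
  q∣1+p⇒pq≡6 : q ∣ suc p → p * q ≡ 6
  q∣1+p⇒pq≡6 q∣1+p = cong₂ _*_ p≡2 (trans q≡1+p (cong suc p≡2))
    where
    q≡1+p = ≤-antisym (∣⇒≤ q∣1+p) p<q
    p≡2 = consecutive-primes p-prime (subst Prime q≡1+p q-prime)
  q∣Φ₆p⇒pq≡6 : q ∣ Φ₆ p → p * q ≡ 6
  q∣Φ₆p⇒pq≡6 q∣Φ₆p with euclidsLemma (suc q) (Φ₆ q) p-prime p∣[1+q]Φ₆q
  ... | inj₁ p∣1+q = let p≡2 , q≡3 = Φ₆-∣-suc p<q p∣1+q q∣Φ₆p in cong₂ _*_ p≡2 q≡3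
  ... | inj₂ p∣Φ₆q = contradiction (Φ₆-descent {{prime⇒nonZero p-prime}} (<⇒≤ p<q) q∣Φ₆p p∣Φ₆q)
                                   (λ { refl → ¬prime[1] p-prime })

mersenne-forced-∣M : ∀ {p x M} → Prime p → x ∣ suc p → suc M ≡ 2 * x → p ∣ M → p ≡ M
mersenne-forced-∣M                _       (divides zero ())             _       _
mersenne-forced-∣M {p} {x} {M}    p-prime (divides 1 1+p≡x+0)          1+M≡2x  p∣M =
  contradiction (∣m+n∣m⇒∣n (subst (p ∣_) M≡2p+1 p∣M) (n∣m*n 2)) (prime∤1 p-prime)
  where
  M≡2p+1 : M ≡ 2 * p + 1
  M≡2p+1 = suc-injective (begin
    suc M            ≡⟨ 1+M≡2x ⟩
    2 * x            ≡⟨ cong (2 *_) (trans 1+p≡x+0 (+-identityʳ x)) ⟨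
    2 * suc p        ≡⟨ solve (p ∷ []) ⟩
    suc (2 * p + 1)  ∎)
    where open ≡-Reasoning
mersenne-forced-∣M                _       (divides 2 1+p≡2x)           1+M≡2x  _   =
  suc-injective (trans 1+p≡2x (sym 1+M≡2x))
mersenne-forced-∣M {x = zero}     _       (divides c@(suc (suc (suc _))) 1+p≡0) _ _ =
  contradiction (trans 1+p≡0 (*-zeroʳ c)) λ ()
mersenne-forced-∣M {p} {x@(suc _)} {M} _ (divides (suc (suc (suc c))) 1+p≡[3+c]x) 1+M≡2x p∣M =
  contradiction (∣⇒≤ {{M≢0}} p∣M) (<⇒≱ M<p)
  where
  M<p : M < p
  M<p = ≤-pred (begin-strict
    suc M                     ≡⟨ 1+M≡2x ⟩
    2 * x                     <⟨ *-monoˡ-< x {2} {suc (suc (suc c))} (s≤s (s≤s (s≤s z≤n))) ⟩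
    suc (suc (suc c)) * x     ≡⟨ 1+p≡[3+c]x ⟨
    suc p                     ∎)
    where open ≤-Reasoning
  M≢0 : NonZero M
  M≢0 = ≢-nonZero λ { refl → 2∤1 (divides x (trans 1+M≡2x (*-comm 2 x))) }

Φ₃-divisor-equation : ∀ {p c x} .{{_ : NonZero x}} → suc p ≡ c * x → p ∣ Φ₃ (2 * x) →
                      ∃ λ j → j * c * x ≡ 4 * x + (2 + j + c)
Φ₃-divisor-equation {p} {c} {x} 1+p≡cx (divides k Φ₃≡kp) = conclude x∣1+k
  where
  k*cx≡x[2+4x]+1+k : k * (c * x) ≡ x * (2 + 4 * x) + (1 + k)
  k*cx≡x[2+4x]+1+k = begin
    k * (c * x)                               ≡⟨ cong (k *_) 1+p≡cx ⟨
    k * suc p                                 ≡⟨ *-suc k p ⟩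
    k + k * p                                 ≡⟨ cong (k +_) Φ₃≡kp ⟨
    k + (1 + 2 * x + 2 * x * (2 * x))         ≡⟨ solve (k ∷ x ∷ []) ⟩
    x * (2 + 4 * x) + (1 + k)                 ∎
    where open ≡-Reasoning
  x∣1+k : x ∣ 1 + k
  x∣1+k = ∣m+n∣m⇒∣n (subst (x ∣_) k*cx≡x[2+4x]+1+k (∣n⇒∣m*n k (n∣m*n c))) (m∣m*n (2 + 4 * x))
  conclude : x ∣ 1 + k → ∃ λ j → j * c * x ≡ 4 * x + (2 + j + c)
  conclude (divides j 1+k≡jx) = j , *-cancelˡ-≡ _ _ x (begin
    x * (j * c * x)                           ≡⟨ solve (x ∷ j ∷ c ∷ []) ⟩
    j * x * (c * x)                           ≡⟨ cong (_* (c * x)) 1+k≡jx ⟨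
    c * x + k * (c * x)                       ≡⟨ cong (c * x +_) k*cx≡x[2+4x]+1+k ⟩
    c * x + (x * (2 + 4 * x) + (1 + k))       ≡⟨ cong (λ y → c * x + (x * (2 + 4 * x) + y)) 1+k≡jx ⟩
    c * x + (x * (2 + 4 * x) + j * x)         ≡⟨ solve (x ∷ j ∷ c ∷ []) ⟩
    x * (4 * x + (2 + j + c))                 ∎)
    where open ≡-Reasoning

jcx-solutions : List (ℕ × ℕ)
jcx-solutions = (1 , 2) ∷ (2 , 2) ∷ (4 , 2) ∷ (11 , 2) ∷ (1 , 8) ∷ (5 , 8) ∷ []

jcx-bound : ∀ {j c x} → 12 ≤ j → 1 ≤ c → 2 ≤ x → 4 * x + (2 + j + c) < j * c * x
jcx-bound 12≤j 1≤c 2≤x = bound (m≤n⇒∃[o]m+o≡n 12≤j) (m≤n⇒∃[o]m+o≡n 1≤c) (m≤n⇒∃[o]m+o≡n 2≤x)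
  where
  bound : ∀ {j c x} → ∃ (λ a → 12 + a ≡ j) → ∃ (λ b → 1 + b ≡ c) → ∃ (λ d → 2 + d ≡ x) →
          4 * x + (2 + j + c) < j * c * x
  bound (a , refl) (b , refl) (d , refl) = subst (suc L ≤_) (expand a b d) (m≤m+n (suc L) R)
    where
    L = 4 * (2 + d) + (2 + (12 + a) + (1 + b))
    R = 8 * d + 23 * b + 12 * b * d + a + a * d + 2 * a * b + a * b * d
    expand : ∀ a b d → suc (4 * (2 + d) + (2 + (12 + a) + (1 + b)))
                         + (8 * d + 23 * b + 12 * b * d + a + a * d + 2 * a * b + a * b * d)
                       ≡ (12 + a) * (1 + b) * (2 + d)
    expand = solve-∀

jcx-solutions-small : ∀ {j} → j < 12 → ∀ {c} → c < 12 → ∀ {x} → x < 25 →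
                      j * c * x ≡ 4 * x + (2 + j + c) → 2 ≤ x → (c , x) ∈ jcx-solutions
jcx-solutions-small = from-yes (allUpTo? (λ j → allUpTo? (λ c → allUpTo? (λ x →
  (j * c * x ≟ 4 * x + (2 + j + c)) →-dec (2 ≤? x) →-dec ((c , x) ∈ᵖ? jcx-solutions)) 25) 12) 12)

jcx-solutions-complete : ∀ {j c x} → 2 ≤ x → j * c * x ≡ 4 * x + (2 + j + c) → (c , x) ∈ jcx-solutions
jcx-solutions-complete {zero}            {c} {x} _ eq = contradiction (sym eq) (m+1+n≢0 (4 * x))
jcx-solutions-complete {j@(suc _)} {zero} {x} _ eq =
  contradiction (trans (sym eq) (cong (_* x) (*-zeroʳ j))) (m+1+n≢0 (4 * x))
jcx-solutions-complete {j@(suc _)} {c@(suc _)} {x} 2≤x eq = jcx-solutions-small j<12 c<12 x<25 eq 2≤x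
  where
  j<12 : j < 12
  j<12 = ≰⇒> λ 12≤j → <⇒≢ (jcx-bound 12≤j (s≤s z≤n) 2≤x) (sym eq)
  c<12 : c < 12
  c<12 = ≰⇒> λ 12≤c → <⇒≢ (jcx-bound 12≤c (s≤s z≤n) 2≤x) (sym eq′)
    where
    eq′ : c * j * x ≡ 4 * x + (2 + c + j)
    eq′ = trans (cong (_* x) (*-comm c j)) (trans eq (cong (λ s → 4 * x + (2 + s)) (+-comm j c)))
  x<25 : x < 25
  x<25 = s≤s (≤-trans (∣⇒≤ (∣m+n∣m⇒∣n (subst (x ∣_) eq (n∣m*n (j * c))) (n∣m*n 4)))
                      (s≤s (s≤s (+-mono-≤ (≤-pred j<12) (≤-pred c<12)))))

-- Apart from (2 , 2), which gives p = M = 3, either p ∈ {1, 21, 39} is not prime, or p = 7 and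
-- 7 * p ∤ M * Φ₃ (suc M), which is 3 * 21 for x = 2 and 15 * 273 for x = 8.
mersenne-forced-jcx : ∀ {p c x M} → (c , x) ∈ jcx-solutions → Prime p → suc p ≡ c * x → suc M ≡ 2 * x →
                      7 * p ∣ M * Φ₃ (suc M) → p ≡ M
mersenne-forced-jcx (here refl) p-prime refl _ _ =
  contradiction p-prime ¬prime[1]
mersenne-forced-jcx (there (here refl)) _ refl refl _ =
  refl
mersenne-forced-jcx (there (there (here refl))) _ refl refl 49∣63 =
  contradiction 49∣63 (from-no (49 ∣? 63))
mersenne-forced-jcx (there (there (there (here refl)))) p-prime refl _ _ =
  contradiction p-prime (from-no (prime? 21))
mersenne-forced-jcx (there (there (there (there (here refl))))) _ refl refl 49∣4095 =
  contradiction 49∣4095 (from-no (49 ∣? 4095))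
mersenne-forced-jcx (there (there (there (there (there (here refl)))))) p-prime refl _ _ =
  contradiction p-prime (from-no (prime? 39))

mersenne-forced : ∀ {p x M} → Prime p → x ∣ suc p → suc M ≡ 2 * x → 2 ≤ x → 7 * p ∣ M * Φ₃ (suc M) → p ≡ M
mersenne-forced {p} {x} {M} p-prime x∣1+p@(divides c 1+p≡cx) 1+M≡2x 2≤x 7p∣MΦ₃[1+M] =
  [ mersenne-forced-∣M p-prime x∣1+p 1+M≡2x , Φ₃-case ]′
  (euclidsLemma M (Φ₃ (suc M)) p-prime (∣-trans (n∣m*n 7) 7p∣MΦ₃[1+M]))
  where
  instance
    x≢0 : NonZero x
    x≢0 = >-nonZero (≤-trans (s≤s z≤n) 2≤x)
  solution⇒p≡M : ∃ (λ j → j * c * x ≡ 4 * x + (2 + j + c)) → p ≡ M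
  solution⇒p≡M (j , eq) = mersenne-forced-jcx (jcx-solutions-complete {j} {c} 2≤x eq) p-prime 1+p≡cx 1+M≡2x 7p∣MΦ₃[1+M]
  Φ₃-case : p ∣ Φ₃ (suc M) → p ≡ M
  Φ₃-case p∣Φ₃[1+M] = solution⇒p≡M (Φ₃-divisor-equation 1+p≡cx (subst (λ y → p ∣ Φ₃ y) 1+M≡2x p∣Φ₃[1+M]))

euclid-form-perfect : ∀ k → Prime (geometricSum 2 k) → Perfect (2 ^ k * geometricSum 2 k)
euclid-form-perfect k M-prime = perfect⁺ {{m*n≢0 (2 ^ k) M {{m^n≢0 2 k}} {{geometricSum≢0 2 k}}}} (begin
  σ₁ (2 ^ k * M)          ≡⟨ σ₁-prime^k* prime[2] (geometricSum-odd ∣-refl k) k ⟩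
  M * σ₁ M                ≡⟨ cong (M *_) (σ₁-prime M-prime) ⟩
  M * suc M               ≡⟨ cong (M *_) (geometricSum-2 k) ⟩
  M * (2 * 2 ^ k)         ≡⟨ rearrange M (2 ^ k) ⟩
  2 ^ k * M + 2 ^ k * M   ∎)
  where
  open ≡-Reasoning
  M = geometricSum 2 k
  rearrange : ∀ m y → m * (2 * y) ≡ y * m + y * m
  rearrange = solve-∀

2^α*prime∣σ₃⇒perfect : (n α p : ℕ) → α ≥ 1 → Prime p → ¬ (2 ∣ p) → n ≡ 2 ^ α * p → n ∣ σ₃ n → (2 ∣ n) × Perfect n
2^α*prime∣σ₃⇒perfect _ α@(suc α′) p (s≤s z≤n) p-prime p-odd refl n∣σ₃n =
  ∣m⇒∣m*n p (m∣m*n (2 ^ α′)) ,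
  subst (λ q → Perfect (2 ^ α * q)) (sym p≡M) (euclid-form-perfect α (subst Prime p≡M p-prime))
  where
  x = 2 ^ α
  M = geometricSum 2 α
  G = geometricSum 8 α
  xp∣G[1+p³] : x * p ∣ G * (1 + p ^ 3)
  xp∣G[1+p³] = subst (x * p ∣_) (trans (σ₃-prime^k* prime[2] p-odd α) (cong (G *_) (σ₃-prime p-prime))) n∣σ₃n
  x∣1+p³ : x ∣ 1 + p ^ 3
  x∣1+p³ = coprime-divisor (prime∤⇒coprime-^ α prime[2] (geometricSum-odd (divides 4 refl) α))
                           (∣-trans (m∣m*n p) xp∣G[1+p³])
  x∣1+p : x ∣ suc p
  x∣1+p = coprime-divisor (prime∤⇒coprime-^ α prime[2] (Φ₆-odd p))
                          (subst (x ∣_) (trans (1+a³≡[1+a]*Φ₆a p) (*-comm (suc p) (Φ₆ p))) x∣1+p³)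
  p∣G : p ∣ G
  p∣G = coprime-divisor (prime∤⇒coprime p-prime (prime∤1+p³ p-prime))
                        (subst (p ∣_) (*-comm G (1 + p ^ 3)) (∣-trans (n∣m*n x) xp∣G[1+p³]))
  p≡M : p ≡ M
  p≡M = mersenne-forced p-prime x∣1+p (geometricSum-2 α) (*-monoʳ-≤ 2 (m^n>0 2 α′))
                        (subst (7 * p ∣_) (geometricSum-8 α) (*-monoʳ-∣ 7 p∣G))

prime-power-decomposition : ∀ {p} → 1 < p → ∀ n .{{_ : NonZero n}} → ∃ λ k → ∃ λ m → ¬ p ∣ m × n ≡ p ^ k * m
prime-power-decomposition {p} 1<p n = go n (<-wellFounded n)
  where
  go : ∀ n .{{_ : NonZero n}} → Acc _<_ n → ∃ λ k → ∃ λ m → ¬ p ∣ m × n ≡ p ^ k * m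
  go n (acc rec) with p ∣? n
  ... | no p∤n               = 0 , n , p∤n , sym (*-identityˡ n)
  ... | yes (divides q refl) = multiply-by-p (go q {{q≢0}} (rec (m<m*n q p {{q≢0}} 1<p)))
    where
    q≢0 : NonZero q
    q≢0 = m*n≢0⇒m≢0 q
    multiply-by-p : (∃ λ k → ∃ λ m → ¬ p ∣ m × q ≡ p ^ k * m) → ∃ λ k → ∃ λ m → ¬ p ∣ m × q * p ≡ p ^ k * m
    multiply-by-p (k , m , p∤m , q≡p^k*m) = suc k , m , p∤m , (begin
      q * p              ≡⟨ *-comm q p ⟩
      p * q              ≡⟨ cong (p *_) q≡p^k*m ⟩
      p * (p ^ k * m)    ≡⟨ *-assoc p (p ^ k) m ⟨
      p ^ suc k * m      ∎)
      where open ≡-Reasoning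

1+d+n≤σ₁ : ∀ {d n} → 1 < d → d < n → d ∣ n → 1 + d + n ≤ σ₁ n
1+d+n≤σ₁ {d} {n} 1<d d<n d∣n = begin
  1 + d + n                        ≡⟨ cong (λ t → 1 + (d + t)) (+-identityʳ n) ⟨
  sum (map id (1 ∷ d ∷ n ∷ []))    ≤⟨ sum-map-mono-⊆ id unique (divisors-unique n) subset ⟩
  σ₁ n                             ∎
  where
  open ≤-Reasoning
  instance
    n≢0 : NonZero n
    n≢0 = >-nonZero (<-trans (<-trans z<s 1<d) d<n)
  unique : Unique (1 ∷ d ∷ n ∷ [])
  unique = (<⇒≢ 1<d All.∷ <⇒≢ (<-trans 1<d d<n) All.∷ All.[])
    AllPairs.∷ (<⇒≢ d<n All.∷ All.[]) AllPairs.∷ All.[] AllPairs.∷ AllPairs.[]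
  subset : 1 ∷ d ∷ n ∷ [] ⊆ divisors n
  subset (here refl)                 = ∈-divisors⁺ (1∣ n)
  subset (there (here refl))         = ∈-divisors⁺ d∣n
  subset (there (there (here refl))) = ∈-divisors⁺ ∣-refl

σ₁≡suc⇒prime : ∀ {n} → 1 < n → σ₁ n ≡ suc n → Prime n
σ₁≡suc⇒prime {n} 1<n σ₁n≡1+n = record
  { nontrivial   = n>1⇒nonTrivial 1<n
  ; notComposite = λ { (hasNonTrivialDivisor {d} d<n d∣n) →
      <⇒≱ (m<n+m n (<-trans z<s (nonTrivial⇒n>1 d)))
          (≤-pred (subst (1 + d + n ≤_) σ₁n≡1+n (1+d+n≤σ₁ (nonTrivial⇒n>1 d) d<n d∣n))) }
  }

coprime-suc : ∀ n → Coprime n (suc n)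
coprime-suc n {d} (d∣n , d∣1+n) = ∣1⇒≡1 (∣m+n∣m⇒∣n (subst (d ∣_) (+-comm 1 n) d∣1+n) d∣n)

σ₁-euclid : ∀ {M m} → 1 < M → .{{_ : NonZero m}} → M * σ₁ m ≡ suc M * m → m ≡ M × Prime M
σ₁-euclid {M} {m} 1<M Mσ₁m≡[1+M]m = conclude M∣m
  where
  instance
    M≢0 : NonZero M
    M≢0 = >-nonZero (<-trans z<s 1<M)
  M∣m : M ∣ m
  M∣m = coprime-divisor (coprime-suc M) (divides (σ₁ m) (trans (sym Mσ₁m≡[1+M]m) (*-comm M (σ₁ m))))
  σ₁m≡t+m : ∀ {t} → m ≡ t * M → σ₁ m ≡ t + m
  σ₁m≡t+m {t} m≡tM = *-cancelˡ-≡ _ _ M (begin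
    M * σ₁ m             ≡⟨ Mσ₁m≡[1+M]m ⟩
    suc M * m            ≡⟨ cong (suc M *_) m≡tM ⟩
    suc M * (t * M)      ≡⟨ solve (M ∷ t ∷ []) ⟩
    M * (t + t * M)      ≡⟨ cong (λ y → M * (t + y)) m≡tM ⟨
    M * (t + m)          ∎)
    where open ≡-Reasoning
  conclude : M ∣ m → m ≡ M × Prime M
  conclude (divides zero m≡0) = contradiction m≡0 (≢-nonZero⁻¹ m)
  conclude (divides 1 m≡M+0) = m≡M , σ₁≡suc⇒prime 1<M (subst (λ y → σ₁ y ≡ suc y) m≡M (σ₁m≡t+m m≡M+0))
    where m≡M = trans m≡M+0 (+-identityʳ M)
  conclude (divides t@(suc (suc _)) m≡tM) = contradiction (σ₁m≡t+m m≡tM) (>⇒≢ σ₁m>t+m)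
    where
    t<m : t < m
    t<m = subst (t <_) (sym m≡tM) (m<m*n t M 1<M)
    σ₁m>t+m : σ₁ m > t + m
    σ₁m>t+m = 1+d+n≤σ₁ (s≤s (s≤s z≤n)) t<m (divides M (trans m≡tM (*-comm t M)))

even-perfect⇒euclid-form : ∀ {n} → 2 ∣ n → Perfect n →
                         ∃ λ k → Prime (geometricSum 2 (suc k)) × n ≡ 2 ^ suc k * geometricSum 2 (suc k)
even-perfect⇒euclid-form {n@(suc _)} 2∣n n-perfect = from-decomposition (prime-power-decomposition (s≤s (s≤s z≤n)) n)
  where
  from-decomposition : (∃ λ k → ∃ λ m → ¬ 2 ∣ m × n ≡ 2 ^ k * m) →
                       ∃ λ k → Prime (geometricSum 2 (suc k)) × n ≡ 2 ^ suc k * geometricSum 2 (suc k)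
  from-decomposition (zero , m , m-odd , n≡1*m) =
    contradiction (subst (2 ∣_) (trans n≡1*m (*-identityˡ m)) 2∣n) m-odd
  from-decomposition (suc k , m , m-odd , n≡2^[1+k]*m) =
    k , proj₂ m≡M×M-prime , trans n≡2^[1+k]*m (cong (2 ^ suc k *_) (proj₁ m≡M×M-prime))
    where
    x = 2 ^ suc k
    M = geometricSum 2 (suc k)
    instance
      m≢0 : NonZero m
      m≢0 = ≢-nonZero λ { refl → m-odd (2 ∣0) }
    Mσ₁m≡[1+M]m : M * σ₁ m ≡ suc M * m
    Mσ₁m≡[1+M]m = begin
      M * σ₁ m          ≡⟨ σ₁-prime^k* prime[2] m-odd (suc k) ⟨
      σ₁ (x * m)        ≡⟨ cong σ₁ n≡2^[1+k]*m ⟨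
      σ₁ n              ≡⟨ perfect⁻ n-perfect ⟩
      n + n             ≡⟨ cong (λ y → y + y) n≡2^[1+k]*m ⟩
      x * m + x * m     ≡⟨ double x m ⟩
      2 * x * m         ≡⟨ cong (_* m) (geometricSum-2 (suc k)) ⟨
      suc M * m         ∎
      where
      open ≡-Reasoning
      double : ∀ y z → y * z + y * z ≡ 2 * y * z
      double = solve-∀
    1<M : 1 < M
    1<M = s≤s (>-nonZero⁻¹ (2 * geometricSum 2 k) {{m*n≢0 2 (geometricSum 2 k) {{_}} {{geometricSum≢0 2 k}}}})
    m≡M×M-prime : m ≡ M × Prime M
    m≡M×M-prime = σ₁-euclid 1<M Mσ₁m≡[1+M]m

euclid-form∣σ₃ : ∀ k → Prime (geometricSum 2 (suc k)) → ¬ (2 ^ suc k * geometricSum 2 (suc k) ≡ 28) →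
                 2 ^ suc k * geometricSum 2 (suc k) ∣ σ₃ (2 ^ suc k * geometricSum 2 (suc k))
euclid-form∣σ₃ k M-prime xM≢28 =
  subst (x * M ∣_) (trans (*-comm (1 + M ^ 3) G) (sym σ₃[xM]≡G[1+M³])) (*-pres-∣ x∣1+M³ M∣G)
  where
  x = 2 ^ suc k
  M = geometricSum 2 (suc k)
  G = geometricSum 8 (suc k)
  σ₃[xM]≡G[1+M³] : σ₃ (x * M) ≡ G * (1 + M ^ 3)
  σ₃[xM]≡G[1+M³] = trans (σ₃-prime^k* prime[2] (geometricSum-odd ∣-refl (suc k)) (suc k)) (cong (G *_) (σ₃-prime M-prime))
  x∣1+M³ : x ∣ 1 + M ^ 3
  x∣1+M³ = subst (x ∣_) (sym (1+a³≡[1+a]*Φ₆a M)) (∣m⇒∣m*n (Φ₆ M) (subst (x ∣_) (sym (geometricSum-2 (suc k))) (n∣m*n 2)))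
  M≢7 : M ≢ 7
  M≢7 M≡7 = xM≢28 (cong₂ _*_ (*-cancelˡ-≡ x 4 2 (trans (sym (geometricSum-2 (suc k))) (cong suc M≡7))) M≡7)
  M∣7⇒M∣G : M ∣ 7 → M ∣ G
  M∣7⇒M∣G M∣7 = [ (λ M≡1 → contradiction (subst Prime M≡1 M-prime) ¬prime[1]) , (λ M≡7 → contradiction M≡7 M≢7) ]′
                 (prime⇒irreducible (from-yes (prime? 7)) M∣7)
  M∣G : M ∣ G
  M∣G = [ M∣7⇒M∣G , id ]′ (euclidsLemma 7 G M-prime (subst (M ∣_) (sym (geometricSum-8 (suc k))) (m∣m*n (Φ₃ (suc M)))))

even-perfect∣σ₃ : (n : ℕ) → 2 ∣ n → Perfect n → ¬ (n ≡ 28) → n ∣ σ₃ n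
even-perfect∣σ₃ n 2∣n n-perfect =
  let k , M-prime , n≡xM = even-perfect⇒euclid-form 2∣n n-perfect
  in subst (λ n → ¬ n ≡ 28 → n ∣ σ₃ n) (sym n≡xM) (euclid-form∣σ₃ k M-prime)

theorem4 :
    ((n p q : ℕ) → Prime p → Prime q → p < q → n ≡ p * q → n ∣ σ₃ n → n ≡ 6)
    × ((n α p : ℕ) → α ≥ 1 → Prime p → ¬ (2 ∣ p) → n ≡ 2 ^ α * p → n ∣ σ₃ n
        → (2 ∣ n) × Perfect n)
    × (6 ∣ σ₃ 6)
    × ((n : ℕ) → 2 ∣ n → Perfect n → ¬ (n ≡ 28) → n ∣ σ₃ n)
theorem4 = semiprime∣σ₃⇒≡6 , 2^α*prime∣σ₃⇒perfect , divides 42 refl , even-perfect∣σ₃
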